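{- For each odd $\ell\geq 3$, there is some $k_0$ such that whenever $k\geq k_0$ is odd, there is a sequence $(G_n)$ of $C_{\ell}$-free graphs, $G_n$ having $n$ vertices, which contain asymptotically more copies of $C_k$ than the balanced blow-up of $C_{\ell+2}$ on $n$ vertices; that is, there is $c>0$ such that for all sufficiently large $n$ the number of copies of $C_k$ in $G_n$ exceeds the number of copies of $C_k$ in the balanced blow-up of $C_{\ell+2}$ on $n$ vertices by at least $c n^k$.
   Context: $C_m$ denotes the cycle of length $m$. A balanced blow-up of a graph $F$ on $n$ vertices is obtained by replacing the vertices of $F$ by independent sets whose sizes sum to $n$ and differ by at most one from each other, and replacing each edge of $F$ by the complete bipartite graph between the corresponding independent sets. (All balanced blow-ups of $C_{\ell+2}$ on $n$ vertices contain asymptotically the same number, up to $o(n^k)$, of copies of $C_k$.) -}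

module Defs where

open import Data.Nat using (ℕ; zero; suc; _+_; _*_; _/_; _%_; _≡ᵇ_; NonZero)
open import Data.Bool using (Bool; true; false; _∧_; _∨_; not; if_then_else_)
open import Data.Fin using (Fin; toℕ)
open import Data.Fin.Properties using (_≟_)
open import Data.List using (List; []; _∷_; [_]; map; concatMap; allFin)
open import Data.Bool.ListAction using (any)
open import Data.Vec using (Vec; toList)
open import Data.Product using (∃-syntax)
open import Relation.Nullary.Decidable using (⌊_⌋)
open import Relation.Binary.PropositionalEquality using (_≡_)

Odd : ℕ → Set
Odd k = ∃[ m ] k ≡ suc (2 * m)

Graph : ℕ → Set
Graph n = Fin n → Fin n → Bool

IsSimpleGraph : ∀ {n} → Graph n → Set
IsSimpleGraph {n} G = (∀ (i j : Fin n) → G i j ≡ G j i) × (∀ (i : Fin n) → G i i ≡ false)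
  where open import Data.Product using (_×_)

tuples : (n k : ℕ) → List (Vec (Fin n) k)
tuples n zero = [ Vec.[] ]
  where import Data.Vec as Vec
tuples n (suc k) = concatMap (λ x → map (x Vec.∷_) (tuples n k)) (allFin n)
  where import Data.Vec as Vec

distinct : ∀ {n} → List (Fin n) → Bool
distinct [] = true
distinct (x ∷ xs) = not (any (λ y → ⌊ x ≟ y ⌋) xs) ∧ distinct xs

walkBack : ∀ {n} → Graph n → Fin n → Fin n → List (Fin n) → Bool
walkBack G first cur [] = G cur first
walkBack G first cur (y ∷ ys) = G cur y ∧ walkBack G first y ys

closedWalk : ∀ {n} → Graph n → List (Fin n) → Bool
closedWalk G [] = false
closedWalk G (x ∷ xs) = walkBack G x x xs

countTrue : ∀ {A : Set} → (A → Bool) → List A → ℕ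
countTrue p [] = 0
countTrue p (x ∷ xs) = if p x then suc (countTrue p xs) else countTrue p xs

labelledCycles : ∀ {n} → (k : ℕ) → Graph n → ℕ
labelledCycles {n} k G =
  countTrue (λ v → distinct (toList v) ∧ closedWalk G (toList v)) (tuples n k)

-- number of copies of C_k in G (subgraphs isomorphic to C_k), for k ≥ 3:
-- labelled copies divided by |Aut(C_k)| = 2k.
copiesC : ∀ {n} → (k : ℕ) → Graph n → ℕ
copiesC zero G = 0
copiesC (suc k) G = labelledCycles (suc k) G / (2 * suc k)

CycleFree : ∀ {n} → ℕ → Graph n → Set
CycleFree ℓ G = copiesC ℓ G ≡ 0

cycleAdj : (m : ℕ) → .{{_ : NonZero m}} → ℕ → ℕ → Bool
cycleAdj m p q = (suc p % m ≡ᵇ q) ∨ (suc q % m ≡ᵇ p)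

-- balanced blow-up of C_m on n vertices: vertex i goes to part (i mod m);
-- part sizes differ by at most one.
balancedBlowUp : (m : ℕ) → .{{_ : NonZero m}} → (n : ℕ) → Graph n
balancedBlowUp m n i j = cycleAdj m (toℕ i % m) (toℕ j % m)

{-# OPTIONS --safe #-}
-- Blow up C_{ℓ+2} so that two adjacent parts are h times as large as the other ℓ parts,
-- which have q ≈ n/(2h+ℓ) vertices each. This graph maps homomorphically onto C_{ℓ+2},
-- whose odd girth exceeds ℓ, so it is C_ℓ-free. A closed k-walk may run once around the
-- small parts and spend its other k − ℓ steps bouncing between the two big parts, so there
-- are at least q^ℓ (hq)^(k−ℓ) closed k-walks; the balanced blow-up has maximum degree about
-- 2n/(ℓ+2), hence at most n (2n/(ℓ+2))^(k−1) of them. With h = 2(ℓ+2) and ℓ ≥ 3 the ratio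
-- of the two bounds grows exponentially in k, so it beats every constant factor once k is
-- large (Bernoulli's inequality), and the O(n^(k−1)) non-injective closed walks do not matter.

module Submission where

open import Defs
open import Data.Nat using (ℕ; zero; suc; pred; _+_; _*_; _∸_; _^_; _≤_; _<_; z≤n; s≤s; s≤s⁻¹; NonZero; >-nonZero; _≡ᵇ_; _<ᵇ_; _<?_)
open import Data.Nat.Properties
open import Data.Nat.DivMod
open import Data.Nat.Tactic.RingSolver using (solve-∀)
open import Data.Bool using (Bool; true; false; _∧_; _∨_; not; if_then_else_; T)
open import Data.Bool.Properties using (∨-comm; ∧-zeroʳ; T-≡)
open import Data.Bool.ListAction using (any)
open import Data.Fin using (Fin; toℕ) renaming (zero to fzero; suc to fsuc)
open import Data.Fin.Properties using () renaming (_≟_ to _≟ᶠ_)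
open import Data.List using (List; []; _∷_; map; concatMap; allFin; tabulate; _++_; length)
open import Data.List.Properties using (length-tabulate)
open import Data.Vec using (Vec; toList) renaming (_∷_ to _∷ᵥ_)
open import Data.Vec.Properties using (length-toList)
open import Data.Empty using (⊥; ⊥-elim)
open import Data.Product using (_×_; _,_; ∃-syntax; Σ-syntax)
open import Data.Sum using (_⊎_; inj₁; inj₂)
open import Relation.Nullary using (¬_)
open import Function using (_∘_; id; Equivalence)
open import Relation.Nullary.Decidable using (⌊_⌋; yes; no)
open import Relation.Binary.PropositionalEquality

private variable
  A B : Set
  n : ℕ

-- Counting

indicator : Bool → ℕ
indicator true = 1
indicator false = 0

sumOver : (A → ℕ) → List A → ℕ
sumOver f [] = 0
sumOver f (x ∷ xs) = f x + sumOver f xs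

sumOver-cong : {f g : A → ℕ} → (∀ x → f x ≡ g x) → ∀ xs → sumOver f xs ≡ sumOver g xs
sumOver-cong f≡g [] = refl
sumOver-cong f≡g (x ∷ xs) = cong₂ _+_ (f≡g x) (sumOver-cong f≡g xs)

sumOver-mono : {f g : A → ℕ} → (∀ x → f x ≤ g x) → ∀ xs → sumOver f xs ≤ sumOver g xs
sumOver-mono f≤g [] = z≤n
sumOver-mono f≤g (x ∷ xs) = +-mono-≤ (f≤g x) (sumOver-mono f≤g xs)

sumOver-+ : (f g : A → ℕ) → ∀ xs → sumOver (λ x → f x + g x) xs ≡ sumOver f xs + sumOver g xs
sumOver-+ f g [] = refl
sumOver-+ f g (x ∷ xs) rewrite sumOver-+ f g xs = +-assoc-swap (f x) (g x) (sumOver f xs) (sumOver g xs)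
  where
  +-assoc-swap : ∀ a b c d → a + b + (c + d) ≡ a + c + (b + d)
  +-assoc-swap = solve-∀

sumOver-*ʳ : (f : A → ℕ) (c : ℕ) → ∀ xs → sumOver (λ x → f x * c) xs ≡ sumOver f xs * c
sumOver-*ʳ f c [] = refl
sumOver-*ʳ f c (x ∷ xs) rewrite sumOver-*ʳ f c xs = sym (*-distribʳ-+ c (f x) (sumOver f xs))

sumOver-allFin-const : ∀ n c → sumOver (λ _ → c) (allFin n) ≡ n * c
sumOver-allFin-const n c = trans (sum-const (allFin n)) (cong (_* c) (length-tabulate {n = n} id))
  where
  sum-const : (xs : List A) → sumOver (λ _ → c) xs ≡ length xs * c
  sum-const [] = refl
  sum-const (x ∷ xs) = cong (c +_) (sum-const xs)

countTrue≡sumOver : (p : A → Bool) → ∀ xs → countTrue p xs ≡ sumOver (indicator ∘ p) xs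
countTrue≡sumOver p [] = refl
countTrue≡sumOver p (x ∷ xs) with p x
... | true = cong suc (countTrue≡sumOver p xs)
... | false = countTrue≡sumOver p xs

sumOver-indicator : (p : A → Bool) (c : ℕ) → ∀ xs → sumOver (λ x → indicator (p x) * c) xs ≡ countTrue p xs * c
sumOver-indicator p c xs = trans (sumOver-*ʳ (indicator ∘ p) c xs) (cong (_* c) (sym (countTrue≡sumOver p xs)))

countTrue-++ : (p : A → Bool) → ∀ xs ys → countTrue p (xs ++ ys) ≡ countTrue p xs + countTrue p ys
countTrue-++ p [] ys = refl
countTrue-++ p (x ∷ xs) ys with p x
... | true = cong suc (countTrue-++ p xs ys)
... | false = countTrue-++ p xs ys

countTrue-map : (p : B → Bool) (f : A → B) → ∀ xs → countTrue p (map f xs) ≡ countTrue (p ∘ f) xs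
countTrue-map p f [] = refl
countTrue-map p f (x ∷ xs) with p (f x)
... | true = cong suc (countTrue-map p f xs)
... | false = countTrue-map p f xs

countTrue-const : (b : Bool) → (xs : List A) → countTrue (λ _ → b) xs ≡ indicator b * length xs
countTrue-const true [] = refl
countTrue-const true (x ∷ xs) = cong suc (countTrue-const true xs)
countTrue-const false [] = refl
countTrue-const false (x ∷ xs) = countTrue-const false xs

countTrue-∧ˡ : (b : Bool) (q : A → Bool) → ∀ xs → countTrue (λ v → b ∧ q v) xs ≡ indicator b * countTrue q xs
countTrue-∧ˡ true q xs = sym (+-identityʳ _)
countTrue-∧ˡ false q xs = countTrue-const false xs

countTrue-≤-length : (p : A → Bool) → ∀ xs → countTrue p xs ≤ length xs
countTrue-≤-length p [] = z≤n
countTrue-≤-length p (x ∷ xs) with p x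
... | true = s≤s (countTrue-≤-length p xs)
... | false = m≤n⇒m≤1+n (countTrue-≤-length p xs)

countTrue-mono : {p q : A → Bool} → (∀ x → p x ≡ true → q x ≡ true) → ∀ xs → countTrue p xs ≤ countTrue q xs
countTrue-mono p⇒q [] = z≤n
countTrue-mono {p = p} {q} p⇒q (x ∷ xs) with p x in px | q x in qx
... | true | true = s≤s (countTrue-mono p⇒q xs)
... | false | true = m≤n⇒m≤1+n (countTrue-mono p⇒q xs)
... | false | false = countTrue-mono p⇒q xs
... | true | false with () ← trans (sym (p⇒q x px)) qx

countTrue-∨ : (p q : A → Bool) → ∀ xs → countTrue (λ x → p x ∨ q x) xs ≤ countTrue p xs + countTrue q xs
countTrue-∨ p q [] = z≤n
countTrue-∨ p q (x ∷ xs) with p x | q x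
... | true | true = s≤s (≤-trans (countTrue-∨ p q xs) (+-monoʳ-≤ _ (n≤1+n _)))
... | true | false = s≤s (countTrue-∨ p q xs)
... | false | true = ≤-trans (s≤s (countTrue-∨ p q xs)) (≤-reflexive (sym (+-suc _ _)))
... | false | false = countTrue-∨ p q xs

countTrue-allFalse : (p : A → Bool) → (∀ x → p x ≡ false) → ∀ xs → countTrue p xs ≡ 0
countTrue-allFalse p never [] = refl
countTrue-allFalse p never (x ∷ xs) rewrite never x = countTrue-allFalse p never xs

countTrue-tuples : ∀ n k (p : Vec (Fin n) (suc k) → Bool) →
  countTrue p (tuples n (suc k)) ≡ sumOver (λ x → countTrue (p ∘ (x ∷ᵥ_)) (tuples n k)) (allFin n)
countTrue-tuples n k p = go (allFin n)
  where
  go : ∀ xs → countTrue p (concatMap (λ x → map (x ∷ᵥ_) (tuples n k)) xs)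
              ≡ sumOver (λ x → countTrue (p ∘ (x ∷ᵥ_)) (tuples n k)) xs
  go [] = refl
  go (x ∷ xs) = trans (countTrue-++ p (map (x ∷ᵥ_) (tuples n k)) _)
                  (cong₂ _+_ (countTrue-map p (x ∷ᵥ_) (tuples n k)) (go xs))

length-tuples : ∀ n k → length (tuples n k) ≡ n ^ k
length-tuples n zero = refl
length-tuples n (suc k) = begin
  length (tuples n (suc k))                                    ≡⟨ sym (count-true (tuples n (suc k))) ⟩
  countTrue (λ _ → true) (tuples n (suc k))                    ≡⟨ countTrue-tuples n k (λ _ → true) ⟩
  sumOver (λ _ → countTrue (λ _ → true) (tuples n k)) (allFin n) ≡⟨ sumOver-allFin-const n _ ⟩
  n * countTrue (λ _ → true) (tuples n k)                      ≡⟨ cong (n *_) (count-true (tuples n k)) ⟩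
  n * length (tuples n k)                                      ≡⟨ cong (n *_) (length-tuples n k) ⟩
  n * n ^ k                                                    ∎
  where
  open ≡-Reasoning
  count-true : (xs : List A) → countTrue (λ _ → true) xs ≡ length xs
  count-true xs = trans (countTrue-const true xs) (+-identityʳ _)

countBelow : (ℕ → Bool) → ℕ → ℕ
countBelow h zero = 0
countBelow h (suc n) = indicator (h 0) + countBelow (h ∘ suc) n

countTrue-tabulate : (g : Fin n → A) (p : A → Bool) (h : ℕ → Bool) →
  (∀ i → p (g i) ≡ h (toℕ i)) → countTrue p (tabulate g) ≡ countBelow h n
countTrue-tabulate {zero} g p h eq = refl
countTrue-tabulate {suc n} g p h eq with p (g fzero) | eq fzero
... | true | e rewrite sym e = cong suc (countTrue-tabulate (g ∘ fsuc) p (h ∘ suc) (eq ∘ fsuc))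
... | false | e rewrite sym e = countTrue-tabulate (g ∘ fsuc) p (h ∘ suc) (eq ∘ fsuc)

countTrue-allFin : ∀ n (h : ℕ → Bool) → countTrue (h ∘ toℕ) (allFin n) ≡ countBelow h n
countTrue-allFin n h = countTrue-tabulate {n} id (h ∘ toℕ) h (λ _ → refl)

countBelow-+ : ∀ h a b → countBelow h (a + b) ≡ countBelow h a + countBelow (λ i → h (a + i)) b
countBelow-+ h zero b = refl
countBelow-+ h (suc a) b =
  trans (cong (indicator (h 0) +_) (countBelow-+ (h ∘ suc) a b)) (sym (+-assoc (indicator (h 0)) _ _))

countBelow-cong : ∀ {h h'} n → (∀ i → i < n → h i ≡ h' i) → countBelow h n ≡ countBelow h' n
countBelow-cong zero eq = refl
countBelow-cong (suc n) eq =
  cong₂ _+_ (cong indicator (eq 0 (s≤s z≤n))) (countBelow-cong n (λ i i<n → eq (suc i) (s≤s i<n)))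

countBelow-mono : ∀ h {a b} → a ≤ b → countBelow h a ≤ countBelow h b
countBelow-mono h {a} {b} a≤b = begin
  countBelow h a                                        ≤⟨ m≤m+n _ _ ⟩
  countBelow h a + countBelow (λ i → h (a + i)) (b ∸ a) ≡⟨ sym (countBelow-+ h a _) ⟩
  countBelow h (a + (b ∸ a))                            ≡⟨ cong (countBelow h) (m+[n∸m]≡n a≤b) ⟩
  countBelow h b                                        ∎
  where open ≤-Reasoning

countBelow-periodic : ∀ g m .{{_ : NonZero m}} q → countBelow (λ i → g (i % m)) (q * m) ≡ q * countBelow g m
countBelow-periodic g m zero = refl
countBelow-periodic g m (suc q) = trans (countBelow-+ (λ i → g (i % m)) m (q * m))
  (cong₂ _+_ (countBelow-cong m (λ i i<m → cong g (m<n⇒m%n≡m i<m)))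
             (trans (countBelow-cong (q * m) (λ i _ → cong g (trans (cong (_% m) (+-comm m i)) ([m+n]%n≡m%n i m))))
                    (countBelow-periodic g m q)))

countBelow-∨ : ∀ g h n → countBelow (λ i → g i ∨ h i) n ≤ countBelow g n + countBelow h n
countBelow-∨ g h n = begin
  countBelow (λ i → g i ∨ h i) n                                  ≡⟨ sym (countTrue-allFin n _) ⟩
  countTrue (λ i → g (toℕ i) ∨ h (toℕ i)) (allFin n)              ≤⟨ countTrue-∨ (g ∘ toℕ) (h ∘ toℕ) (allFin n) ⟩
  countTrue (g ∘ toℕ) (allFin n) + countTrue (h ∘ toℕ) (allFin n) ≡⟨ cong₂ _+_ (countTrue-allFin n g) (countTrue-allFin n h) ⟩
  countBelow g n + countBelow h n                                 ∎
  where open ≤-Reasoning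

countBelow-none : ∀ h n → (∀ i → i < n → h i ≡ true → ⊥) → countBelow h n ≡ 0
countBelow-none h zero never = refl
countBelow-none h (suc n) never with h 0 in h0
... | true = ⊥-elim (never 0 (s≤s z≤n) h0)
... | false = countBelow-none (h ∘ suc) n (λ i i<n → never (suc i) (s≤s i<n))

countBelow-≤1 : ∀ h n c → (∀ i → i < n → h i ≡ true → i ≡ c) → countBelow h n ≤ 1
countBelow-≤1 h zero c only = z≤n
countBelow-≤1 h (suc n) c only with h 0 in h0
... | true = s≤s (≤-reflexive (countBelow-none (h ∘ suc) n
                 (λ i i<n hi → 0≢1+n (trans (only 0 (s≤s z≤n) h0) (sym (only (suc i) (s≤s i<n) hi))))))
... | false = countBelow-≤1 (h ∘ suc) n (pred c) (λ i i<n hi → cong pred (only (suc i) (s≤s i<n) hi))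

countBelow-all : ∀ h a → (∀ i → i < a → h i ≡ true) → countBelow h a ≡ a
countBelow-all h zero always = refl
countBelow-all h (suc a) always rewrite always 0 (s≤s z≤n) =
  cong suc (countBelow-all (h ∘ suc) a (λ i i<a → always (suc i) (s≤s i<a)))

countBelow-pos : ∀ h a r → r < a → h r ≡ true → 1 ≤ countBelow h a
countBelow-pos h (suc a) zero r<a hr rewrite hr = s≤s z≤n
countBelow-pos h (suc a) (suc r) (s≤s r<a) hr =
  ≤-trans (countBelow-pos (h ∘ suc) a r r<a hr) (m≤n+m _ (indicator (h 0)))

≡ᵇ-sound : ∀ {m n} → (m ≡ᵇ n) ≡ true → m ≡ n
≡ᵇ-sound {m} {n} e = ≡ᵇ⇒≡ m n (Equivalence.from T-≡ e)

≡ᵇ-refl : ∀ m → (m ≡ᵇ m) ≡ true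
≡ᵇ-refl zero = refl
≡ᵇ-refl (suc m) = ≡ᵇ-refl m

-- Walks and labelled cycles

module _ {n : ℕ} (G : Graph n) where

  -- walks c → y₁ → ⋯ → yⱼ → f
  walksBack : Fin n → Fin n → ℕ → ℕ
  walksBack f c j = countTrue (λ v → walkBack G f c (toList v)) (tuples n j)

  closedWalks : ℕ → ℕ
  closedWalks k = countTrue (λ v → closedWalk G (toList v)) (tuples n k)

  degree : Fin n → ℕ
  degree c = countTrue (G c) (allFin n)

  walksBack-suc : ∀ f c j →
    walksBack f c (suc j) ≡ sumOver (λ x → indicator (G c x) * walksBack f x j) (allFin n)
  walksBack-suc f c j = trans (countTrue-tuples n j _)
    (sumOver-cong (λ x → countTrue-∧ˡ (G c x) (λ v → walkBack G f x (toList v)) (tuples n j)) (allFin n))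

  walksBack-≤ : ∀ D → (∀ c → degree c ≤ D) → ∀ f c j → walksBack f c j ≤ D ^ j
  walksBack-≤ D deg≤D f c zero = countTrue-≤-length (λ v → walkBack G f c (toList v)) (tuples n zero)
  walksBack-≤ D deg≤D f c (suc j) = begin
    walksBack f c (suc j)                                           ≡⟨ walksBack-suc f c j ⟩
    sumOver (λ x → indicator (G c x) * walksBack f x j) (allFin n) ≤⟨ sumOver-mono (λ x → *-monoʳ-≤ (indicator (G c x)) (walksBack-≤ D deg≤D f x j)) (allFin n) ⟩
    sumOver (λ x → indicator (G c x) * D ^ j) (allFin n)            ≡⟨ sumOver-indicator (G c) (D ^ j) (allFin n) ⟩
    degree c * D ^ j                                                ≤⟨ *-monoˡ-≤ (D ^ j) (deg≤D c) ⟩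
    D * D ^ j                                                       ∎
    where open ≤-Reasoning

  walksBack-≥ : ∀ (P : Fin n → Bool) f c j w →
    (∀ x → P x ≡ true → G c x ≡ true) → (∀ x → P x ≡ true → w ≤ walksBack f x j) →
    countTrue P (allFin n) * w ≤ walksBack f c (suc j)
  walksBack-≥ P f c j w adjacent many = begin
    countTrue P (allFin n) * w                                      ≡⟨ sym (sumOver-indicator P w (allFin n)) ⟩
    sumOver (λ x → indicator (P x) * w) (allFin n)                  ≤⟨ sumOver-mono pointwise (allFin n) ⟩
    sumOver (λ x → indicator (G c x) * walksBack f x j) (allFin n) ≡⟨ sym (walksBack-suc f c j) ⟩
    walksBack f c (suc j)                                           ∎
    where
    open ≤-Reasoning
    pointwise : ∀ x → indicator (P x) * w ≤ indicator (G c x) * walksBack f x j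
    pointwise x with P x in px
    ... | false = z≤n
    ... | true rewrite adjacent x px = +-monoˡ-≤ 0 (many x px)

  closedWalks-suc : ∀ j → closedWalks (suc j) ≡ sumOver (λ x → walksBack x x j) (allFin n)
  closedWalks-suc j = countTrue-tuples n j _

  closedWalks-≤ : ∀ D → (∀ c → degree c ≤ D) → ∀ j → closedWalks (suc j) ≤ n * D ^ j
  closedWalks-≤ D deg≤D j = begin
    closedWalks (suc j)                         ≡⟨ closedWalks-suc j ⟩
    sumOver (λ x → walksBack x x j) (allFin n) ≤⟨ sumOver-mono (λ x → walksBack-≤ D deg≤D x x j) (allFin n) ⟩
    sumOver (λ _ → D ^ j) (allFin n)            ≡⟨ sumOver-allFin-const n (D ^ j) ⟩
    n * D ^ j                                   ∎
    where open ≤-Reasoning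

  closedWalks-≥ : ∀ (P : Fin n → Bool) j w →
    (∀ x → P x ≡ true → w ≤ walksBack x x j) → countTrue P (allFin n) * w ≤ closedWalks (suc j)
  closedWalks-≥ P j w many = begin
    countTrue P (allFin n) * w                  ≡⟨ sym (sumOver-indicator P w (allFin n)) ⟩
    sumOver (λ x → indicator (P x) * w) (allFin n) ≤⟨ sumOver-mono pointwise (allFin n) ⟩
    sumOver (λ x → walksBack x x j) (allFin n) ≡⟨ sym (closedWalks-suc j) ⟩
    closedWalks (suc j)                         ∎
    where
    open ≤-Reasoning
    pointwise : ∀ x → indicator (P x) * w ≤ walksBack x x j
    pointwise x with P x in px
    ... | false = z≤n
    ... | true = ≤-trans (≤-reflexive (+-identityʳ w)) (many x px)

nonInjective : ℕ → ℕ → ℕ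
nonInjective n k = countTrue (λ v → not (distinct (toList v))) (tuples n k)

labelledCycles-≤ : (G : Graph n) → ∀ k → labelledCycles k G ≤ closedWalks G k
labelledCycles-≤ {n} G k = countTrue-mono (λ v → ∧-true-right (distinct (toList v))) (tuples n k)
  where
  ∧-true-right : ∀ a {b} → a ∧ b ≡ true → b ≡ true
  ∧-true-right true e = e

closedWalks-≤-labelledCycles+nonInjective : (G : Graph n) → ∀ k →
  closedWalks G k ≤ labelledCycles k G + nonInjective n k
closedWalks-≤-labelledCycles+nonInjective {n} G k =
  ≤-trans (countTrue-mono split (tuples n k)) (countTrue-∨ _ _ (tuples n k))
  where
  split : ∀ v → closedWalk G (toList v) ≡ true →
    ((distinct (toList v) ∧ closedWalk G (toList v)) ∨ not (distinct (toList v))) ≡ true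
  split v cw rewrite cw with distinct (toList v)
  ... | true = refl
  ... | false = refl

tuplesThrough : ∀ n → Fin n → ℕ → ℕ
tuplesThrough n x k = countTrue (λ v → any (λ y → ⌊ x ≟ᶠ y ⌋) (toList v)) (tuples n k)

countTrue-≟-≤1 : (x : Fin n) → countTrue (λ y → ⌊ x ≟ᶠ y ⌋) (allFin n) ≤ 1
countTrue-≟-≤1 {n} x = begin
  countTrue (λ y → ⌊ x ≟ᶠ y ⌋) (allFin n)     ≤⟨ countTrue-mono same-index (allFin n) ⟩
  countTrue ((toℕ x ≡ᵇ_) ∘ toℕ) (allFin n)   ≡⟨ countTrue-allFin n (toℕ x ≡ᵇ_) ⟩
  countBelow (toℕ x ≡ᵇ_) n                    ≤⟨ countBelow-≤1 _ n (toℕ x) (λ i _ e → sym (≡ᵇ-sound e)) ⟩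
  1                                            ∎
  where
  open ≤-Reasoning
  same-index : ∀ y → ⌊ x ≟ᶠ y ⌋ ≡ true → (toℕ x ≡ᵇ toℕ y) ≡ true
  same-index y e with x ≟ᶠ y
  ... | yes refl = ≡ᵇ-refl (toℕ x)

tuplesThrough-suc : ∀ n x k → tuplesThrough n x (suc k) ≤ n ^ k + n * tuplesThrough n x k
tuplesThrough-suc n x k = begin
  tuplesThrough n x (suc k)
    ≡⟨ countTrue-tuples n k _ ⟩
  sumOver (λ y → countTrue (λ v → ⌊ x ≟ᶠ y ⌋ ∨ through v) (tuples n k)) (allFin n)
    ≤⟨ sumOver-mono split (allFin n) ⟩
  sumOver (λ y → indicator ⌊ x ≟ᶠ y ⌋ * n ^ k + tuplesThrough n x k) (allFin n)
    ≡⟨ sumOver-+ _ _ (allFin n) ⟩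
  sumOver (λ y → indicator ⌊ x ≟ᶠ y ⌋ * n ^ k) (allFin n) + sumOver (λ _ → tuplesThrough n x k) (allFin n)
    ≡⟨ cong₂ _+_ (sumOver-indicator _ _ (allFin n)) (sumOver-allFin-const n _) ⟩
  countTrue (λ y → ⌊ x ≟ᶠ y ⌋) (allFin n) * n ^ k + n * tuplesThrough n x k
    ≤⟨ +-monoˡ-≤ _ (≤-trans (*-monoˡ-≤ (n ^ k) (countTrue-≟-≤1 x)) (≤-reflexive (+-identityʳ _))) ⟩
  n ^ k + n * tuplesThrough n x k ∎
  where
  open ≤-Reasoning
  through : Vec (Fin n) k → Bool
  through v = any (λ y → ⌊ x ≟ᶠ y ⌋) (toList v)
  split : ∀ y → countTrue (λ v → ⌊ x ≟ᶠ y ⌋ ∨ through v) (tuples n k) ≤ indicator ⌊ x ≟ᶠ y ⌋ * n ^ k + tuplesThrough n x k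
  split y = ≤-trans (countTrue-∨ (λ _ → ⌊ x ≟ᶠ y ⌋) through (tuples n k))
    (+-monoˡ-≤ _ (≤-reflexive (trans (countTrue-const ⌊ x ≟ᶠ y ⌋ (tuples n k)) (cong (indicator ⌊ x ≟ᶠ y ⌋ *_) (length-tuples n k)))))

tuplesThrough-≤ : ∀ n x k → n * tuplesThrough n x k ≤ k * n ^ k
tuplesThrough-≤ n x zero = ≤-reflexive (*-zeroʳ n)
tuplesThrough-≤ n x (suc k) = begin
  n * tuplesThrough n x (suc k)                ≤⟨ *-monoʳ-≤ n (tuplesThrough-suc n x k) ⟩
  n * (n ^ k + n * tuplesThrough n x k)        ≤⟨ *-monoʳ-≤ n (+-monoʳ-≤ (n ^ k) (tuplesThrough-≤ n x k)) ⟩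
  n * (n ^ k + k * n ^ k)                      ≡⟨ rearrange n (n ^ k) k ⟩
  suc k * (n * n ^ k)                          ∎
  where
  open ≤-Reasoning
  rearrange : ∀ a b c → a * (b + c * b) ≡ suc c * (a * b)
  rearrange = solve-∀

nonInjective-suc : ∀ n k → nonInjective n (suc k) ≤ sumOver (λ y → tuplesThrough n y k + nonInjective n k) (allFin n)
nonInjective-suc n k = ≤-trans (≤-reflexive (countTrue-tuples n k _)) (sumOver-mono split (allFin n))
  where
  split : ∀ y → countTrue (λ v → not (not (any (λ z → ⌊ y ≟ᶠ z ⌋) (toList v)) ∧ distinct (toList v))) (tuples n k)
                ≤ tuplesThrough n y k + nonInjective n k
  split y = ≤-trans (countTrue-mono repeated (tuples n k)) (countTrue-∨ _ _ (tuples n k))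
    where
    repeated : ∀ v → not (not (any (λ z → ⌊ y ≟ᶠ z ⌋) (toList v)) ∧ distinct (toList v)) ≡ true →
               (any (λ z → ⌊ y ≟ᶠ z ⌋) (toList v) ∨ not (distinct (toList v))) ≡ true
    repeated v e with any (λ z → ⌊ y ≟ᶠ z ⌋) (toList v) | distinct (toList v)
    ... | true | _ = refl
    ... | false | d = e

n*nonInjective-≤ : ∀ n k → n * nonInjective n k ≤ k * k * n ^ k
n*nonInjective-≤ n zero = ≤-reflexive (*-zeroʳ n)
n*nonInjective-≤ n (suc k) = begin
  n * nonInjective n (suc k)
    ≤⟨ *-monoʳ-≤ n (nonInjective-suc n k) ⟩
  n * sumOver (λ y → tuplesThrough n y k + nonInjective n k) (allFin n)
    ≡⟨ trans (*-comm n _) (sym (sumOver-*ʳ _ n (allFin n))) ⟩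
  sumOver (λ y → (tuplesThrough n y k + nonInjective n k) * n) (allFin n)
    ≤⟨ sumOver-mono bound (allFin n) ⟩
  sumOver (λ _ → k * n ^ k + k * k * n ^ k) (allFin n)
    ≡⟨ sumOver-allFin-const n _ ⟩
  n * (k * n ^ k + k * k * n ^ k)
    ≤⟨ m≤m+n _ (suc k * (n * n ^ k)) ⟩
  n * (k * n ^ k + k * k * n ^ k) + suc k * (n * n ^ k)
    ≡⟨ rearrange n (n ^ k) k ⟩
  suc k * suc k * (n * n ^ k) ∎
  where
  open ≤-Reasoning
  bound : ∀ y → (tuplesThrough n y k + nonInjective n k) * n ≤ k * n ^ k + k * k * n ^ k
  bound y = ≤-trans (≤-reflexive (trans (*-distribʳ-+ n (tuplesThrough n y k) (nonInjective n k)) (cong₂ _+_ (*-comm _ n) (*-comm _ n))))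
                    (+-mono-≤ (tuplesThrough-≤ n y k) (n*nonInjective-≤ n k))
  rearrange : ∀ a b c → a * (c * b + c * c * b) + suc c * (a * b) ≡ suc c * suc c * (a * b)
  rearrange = solve-∀

nonInjective-≤ : ∀ n .{{_ : NonZero n}} K → nonInjective n (suc K) ≤ suc K * suc K * n ^ K
nonInjective-≤ n K = *-cancelˡ-≤ n (subst (n * nonInjective n (suc K) ≤_) (swap n (suc K * suc K) (n ^ K)) (n*nonInjective-≤ n (suc K)))
  where
  swap : ∀ x y z → y * (x * z) ≡ x * (y * z)
  swap = solve-∀

-- Blow-ups of cycles

module _ (m : ℕ) .{{_ : NonZero m}} where

  [a%m+b]%m≡[a+b]%m : ∀ a b → ((a % m) + b) % m ≡ (a + b) % m
  [a%m+b]%m≡[a+b]%m a b = trans (%-distribˡ-+ (a % m) b m)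
    (trans (cong (λ z → (z + b % m) % m) (m%n%n≡m%n a m)) (sym (%-distribˡ-+ a b m)))

  %-cong-+ʳ : ∀ {a b} c → a % m ≡ b % m → (a + c) % m ≡ (b + c) % m
  %-cong-+ʳ {a} {b} c e = begin
    (a + c) % m         ≡⟨ sym ([a%m+b]%m≡[a+b]%m a c) ⟩
    (a % m + c) % m     ≡⟨ cong (λ z → (z + c) % m) e ⟩
    (b % m + c) % m     ≡⟨ [a%m+b]%m≡[a+b]%m b c ⟩
    (b + c) % m         ∎
    where open ≡-Reasoning

  [a+d]%m≡a%m⇒d≡0 : ∀ a d → d < m → (a + d) % m ≡ a % m → d ≡ 0
  [a+d]%m≡a%m⇒d≡0 a d d<m e = go (a % m) (m%n<n a m) (trans ([a%m+b]%m≡[a+b]%m a d) e)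
    where
    go : ∀ r → r < m → (r + d) % m ≡ r → d ≡ 0
    go r r<m e' with r + d <? m
    ... | yes r+d<m = +-cancelˡ-≡ r d 0 (trans (trans (sym (m<n⇒m%n≡m r+d<m)) e') (sym (+-identityʳ r)))
    ... | no r+d≮m = ⊥-elim (<-irrefl d≡m d<m)
      where
      e₀ = r + d ∸ m
      m+e₀ : m + e₀ ≡ r + d
      m+e₀ = m+[n∸m]≡n (≮⇒≥ r+d≮m)
      e₀<m : e₀ < m
      e₀<m = +-cancelˡ-< m e₀ m (subst (_< m + m) (sym m+e₀) (+-mono-< r<m d<m))
      e₀≡r : e₀ ≡ r
      e₀≡r = trans (sym (m<n⇒m%n≡m e₀<m))
               (trans (sym ([m+n]%n≡m%n e₀ m)) (trans (cong (_% m) (trans (+-comm e₀ m) m+e₀)) e'))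
      d≡m : d ≡ m
      d≡m = +-cancelˡ-≡ r d m (trans (sym m+e₀) (trans (+-comm m e₀) (cong (_+ m) e₀≡r)))

  +-%-injectiveʳ : ∀ a {x y} → x ≤ y → y < m → (a + x) % m ≡ (a + y) % m → x ≡ y
  +-%-injectiveʳ a {x} {y} x≤y y<m e = begin
    x          ≡⟨ sym (+-identityʳ x) ⟩
    x + 0      ≡⟨ cong (x +_) (sym d≡0) ⟩
    x + d      ≡⟨ m+[n∸m]≡n x≤y ⟩
    y          ∎
    where
    open ≡-Reasoning
    d = y ∸ x
    d≡0 : d ≡ 0
    d≡0 = [a+d]%m≡a%m⇒d≡0 (a + x) d (≤-<-trans (m∸n≤m y x) y<m)
      (trans (cong (_% m) (trans (+-assoc a x d) (cong (a +_) (m+[n∸m]≡n x≤y)))) (sym e))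

  -- b is reached from a by L steps of C_m, x of them forward and y backward.
  Reach : ℕ → ℕ → ℕ → Set
  Reach a b L = ∃[ x ] ∃[ y ] (x + y ≡ L × (a + x) % m ≡ (b + y) % m)

  Reach-step : ∀ {a b b' L} → cycleAdj m b b' ≡ true → Reach a b L → Reach a b' (suc L)
  Reach-step {a} {b} {b'} adj (x , y , x+y≡L , e) with suc b % m ≡ᵇ b' in forward
  ... | true = suc x , y , cong suc x+y≡L , (begin
    (a + suc x) % m      ≡⟨ cong (_% m) (trans (+-suc a x) (+-comm 1 (a + x))) ⟩
    ((a + x) + 1) % m    ≡⟨ %-cong-+ʳ 1 e ⟩
    ((b + y) + 1) % m    ≡⟨ cong (_% m) (+-comm (b + y) 1) ⟩
    (suc b + y) % m      ≡⟨ sym ([a%m+b]%m≡[a+b]%m (suc b) y) ⟩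
    (suc b % m + y) % m  ≡⟨ cong (λ z → (z + y) % m) (≡ᵇ-sound forward) ⟩
    (b' + y) % m         ∎)
    where open ≡-Reasoning
  ... | false = x , suc y , trans (+-suc x y) (cong suc x+y≡L) , (begin
    (a + x) % m          ≡⟨ e ⟩
    (b + y) % m          ≡⟨ cong (λ z → (z + y) % m) (sym (≡ᵇ-sound adj)) ⟩
    (suc b' % m + y) % m ≡⟨ [a%m+b]%m≡[a+b]%m (suc b') y ⟩
    (suc b' + y) % m     ≡⟨ cong (_% m) (sym (+-suc b' y)) ⟩
    (b' + suc y) % m     ∎)
    where open ≡-Reasoning

  ¬Reach-odd-short : ∀ a L → Odd L → L < m → ¬ Reach a a L
  ¬Reach-odd-short a L (b , L≡odd) L<m (x , y , x+y≡L , e) =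
    even≢odd x b (trans (double (steps-balance (≤-total x y))) (trans x+y≡L L≡odd))
    where
    x+y<m : x + y < m
    x+y<m = subst (_< m) (sym x+y≡L) L<m
    steps-balance : x ≤ y ⊎ y ≤ x → x ≡ y
    steps-balance (inj₁ x≤y) = +-%-injectiveʳ a x≤y (≤-<-trans (m≤n+m y x) x+y<m) e
    steps-balance (inj₂ y≤x) = sym (+-%-injectiveʳ a y≤x (≤-<-trans (m≤m+n x y) x+y<m) (sym e))
    double : x ≡ y → 2 * x ≡ x + y
    double refl = cong (x +_) (+-identityʳ x)

  cycleBlowUp : (Fin n → ℕ) → Graph n
  cycleBlowUp part i j = cycleAdj m (part i) (part j)

  Reach-walkBack : (part : Fin n → ℕ) → ∀ a ys f c L →
    walkBack (cycleBlowUp part) f c ys ≡ true → Reach a (part c) L → Reach a (part f) (length ys + suc L)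
  Reach-walkBack part a [] f c L walk reach = Reach-step walk reach
  Reach-walkBack part a (y ∷ ys) f c L walk reach with cycleBlowUp part c y in cy
  ... | true = subst (Reach a (part f)) (+-suc (length ys) (suc L))
                 (Reach-walkBack part a ys f y (suc L) walk (Reach-step cy reach))

  closedWalk-odd-short : (part : Fin n → ℕ) → ∀ k → Odd k → k < m →
    (v : Vec (Fin n) k) → closedWalk (cycleBlowUp part) (toList v) ≡ false
  closedWalk-odd-short part .(suc k) odd k<m (_∷ᵥ_ {k} x v) with closedWalk (cycleBlowUp part) (toList (x ∷ᵥ v)) in cw
  ... | false = refl
  ... | true = ⊥-elim (¬Reach-odd-short (part x) (suc k) odd k<m
                 (subst (Reach (part x) (part x)) (trans (+-comm _ 1) (cong suc (length-toList v)))
                   (Reach-walkBack part (part x) (toList v) x x 0 cw (0 , 0 , refl , refl))))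

  cycleBlowUp-CycleFree : (part : Fin n → ℕ) → ∀ ℓ → Odd ℓ → ℓ < m → CycleFree ℓ (cycleBlowUp part)
  cycleBlowUp-CycleFree {n} part ℓ@.(suc (2 * b)) odd@(b , refl) ℓ<m =
    trans (cong (_/ (2 * ℓ)) no-cycles) (0/n≡0 (2 * ℓ))
    where
    no-cycles : labelledCycles ℓ (cycleBlowUp part) ≡ 0
    no-cycles = countTrue-allFalse _
      (λ v → trans (cong (distinct (toList v) ∧_) (closedWalk-odd-short part ℓ odd ℓ<m v)) (∧-zeroʳ _))
      (tuples n ℓ)

  cycleBlowUp-simple : (part : Fin n → ℕ) → 2 ≤ m → (∀ i → part i < m) → IsSimpleGraph (cycleBlowUp part)
  cycleBlowUp-simple part 2≤m part<m =
    (λ i j → ∨-comm (suc (part i) % m ≡ᵇ part j) (suc (part j) % m ≡ᵇ part i)) ,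
    (λ i → cong₂ _∨_ (no-loop (part<m i)) (no-loop (part<m i)))
    where
    no-loop : ∀ {p} → p < m → (suc p % m ≡ᵇ p) ≡ false
    no-loop {p} p<m with suc p % m ≡ᵇ p in e | m≤n⇒m<n∨m≡n p<m
    ... | false | _ = refl
    ... | true | inj₁ 1+p<m = ⊥-elim (<-irrefl (sym (trans (sym (m<n⇒m%n≡m 1+p<m)) (≡ᵇ-sound e))) (n<1+n p))
    ... | true | inj₂ 1+p≡m = ⊥-elim (<-irrefl (sym p≡0) (s≤s⁻¹ (subst (2 ≤_) (sym 1+p≡m) 2≤m)))
      where
      p≡0 : p ≡ 0
      p≡0 = trans (sym (≡ᵇ-sound e)) (trans (cong (_% m) 1+p≡m) (n%n≡0 m))

balancedBlowUp-degree : ∀ m' n (c : Fin n) → let m = suc m' in degree (balancedBlowUp m n) c ≤ suc (n / m) * 2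
balancedBlowUp-degree m' n c = begin
  degree (balancedBlowUp m n) c            ≡⟨ countTrue-allFin n (λ i → neighbour (i % m)) ⟩
  countBelow (λ i → neighbour (i % m)) n   ≤⟨ countBelow-mono _ n≤periods ⟩
  countBelow (λ i → neighbour (i % m)) (suc (n / m) * m) ≡⟨ countBelow-periodic neighbour m (suc (n / m)) ⟩
  suc (n / m) * countBelow neighbour m     ≤⟨ *-monoʳ-≤ (suc (n / m)) two-neighbours ⟩
  suc (n / m) * 2                          ∎
  where
  open ≤-Reasoning
  m = suc m'
  p = toℕ c % m
  neighbour : ℕ → Bool
  neighbour r = cycleAdj m p r
  n≤periods : n ≤ suc (n / m) * m
  n≤periods = subst (_≤ suc (n / m) * m) (sym (m≡m%n+[m/n]*n n m)) (+-monoˡ-≤ _ (<⇒≤ (m%n<n n m)))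
  predecessor : ∀ r → r < m → (suc r % m ≡ᵇ p) ≡ true → r ≡ (p + m') % m
  predecessor r r<m e = sym (begin-equality
    (p + m') % m              ≡⟨ cong (λ z → (z + m') % m) (sym (≡ᵇ-sound {suc r % m} {p} e)) ⟩
    (suc r % m + m') % m      ≡⟨ [a%m+b]%m≡[a+b]%m m (suc r) m' ⟩
    (suc r + m') % m          ≡⟨ cong (_% m) (sym (+-suc r m')) ⟩
    (r + m) % m               ≡⟨ [m+n]%n≡m%n r m ⟩
    r % m                     ≡⟨ m<n⇒m%n≡m r<m ⟩
    r                         ∎)
  two-neighbours : countBelow neighbour m ≤ 2
  two-neighbours = ≤-trans (countBelow-∨ (λ r → suc p % m ≡ᵇ r) (λ r → suc r % m ≡ᵇ p) m)
    (+-mono-≤ (countBelow-≤1 _ m (suc p % m) (λ r _ e → sym (≡ᵇ-sound e)))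
              (countBelow-≤1 _ m ((p + m') % m) predecessor))

-- Closed walks in an unbalanced blow-up

partSize : (Fin n → ℕ) → ℕ → ℕ
partSize {n} part r = countTrue (λ y → part y ≡ᵇ r) (allFin n)

cycleAdj-suc : ∀ m .{{_ : NonZero m}} a → suc a < m → cycleAdj m a (suc a) ≡ true
cycleAdj-suc m a 1+a<m = cong (_∨ (suc (suc a) % m ≡ᵇ a)) (trans (cong (_≡ᵇ suc a) (m<n⇒m%n≡m 1+a<m)) (≡ᵇ-refl (suc a)))

cycleAdj-last : ∀ m' → cycleAdj (suc m') m' 0 ≡ true
cycleAdj-last m' = cong (λ z → (z ≡ᵇ 0) ∨ (1 % suc m' ≡ᵇ m')) (n%n≡0 (suc m'))

-- Walks that run once up through the small parts 2, …, ℓ+1 and then bounce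
-- between the big parts 0 and 1 before returning to part 2.
module _ (ℓ' : ℕ) {n : ℕ} (part : Fin n → ℕ) (p s : ℕ)
  (big₀ : p ≤ partSize part 0) (big₁ : p ≤ partSize part 1)
  (small : ∀ r → 2 ≤ r → r ≤ suc (suc ℓ') → s ≤ partSize part r) where

  private
    m = suc (suc (suc ℓ'))
    G = cycleBlowUp m part

  walksBack-via-part : ∀ {a r f c j w q} → q ≤ partSize part r → cycleAdj m a r ≡ true → part c ≡ a →
    (∀ x → part x ≡ r → w ≤ walksBack G f x j) → q * w ≤ walksBack G f c (suc j)
  walksBack-via-part {r = r} {f} {c} {j} {w} q≤size adj c∈a many = ≤-trans (*-monoˡ-≤ w q≤size)
    (walksBack-≥ G (λ y → part y ≡ᵇ r) f c j w
      (λ x e → trans (cong₂ (cycleAdj m) c∈a (≡ᵇ-sound e)) adj) (λ x e → many x (≡ᵇ-sound e)))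

  module _ (f : Fin n) (f∈2 : part f ≡ 2) where

    bounce-from-1 : ∀ t c → part c ≡ 1 → p ^ (2 * t) ≤ walksBack G f c (2 * t)
    bounce-from-0 : ∀ t c → part c ≡ 0 → p ^ suc (2 * t) ≤ walksBack G f c (suc (2 * t))
    bounce-from-1 zero c c∈1 rewrite c∈1 | f∈2 = ≤-refl
    bounce-from-1 (suc t) c c∈1 = subst (λ j → p ^ j ≤ walksBack G f c j) (sym (*-suc 2 t))
      (walksBack-via-part {f = f} {j = suc (2 * t)} big₀ refl c∈1 (bounce-from-0 t))
    bounce-from-0 t c c∈0 = walksBack-via-part {f = f} {j = 2 * t} big₁ refl c∈0 (bounce-from-1 t)

    climb : ∀ d t c → part c + d ≡ suc (suc ℓ') → 2 ≤ part c →
      s ^ d * p ^ (2 * suc t) ≤ walksBack G f c (d + 2 * suc t)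
    climb zero t c top _ = begin
      1 * p ^ (2 * suc t)                  ≡⟨ *-identityˡ _ ⟩
      p ^ (2 * suc t)                      ≡⟨ cong (p ^_) (*-suc 2 t) ⟩
      p * p ^ suc (2 * t)                  ≤⟨ walksBack-via-part {f = f} {j = suc (2 * t)} big₀ (cycleAdj-last (suc (suc ℓ')))
                                                (trans (sym (+-identityʳ _)) top) (bounce-from-0 t) ⟩
      walksBack G f c (2 + 2 * t)          ≡⟨ cong (walksBack G f c) (sym (*-suc 2 t)) ⟩
      walksBack G f c (2 * suc t)          ∎
      where open ≤-Reasoning
    climb (suc d) t c top 2≤c = begin
      s ^ suc d * p ^ (2 * suc t)          ≡⟨ *-assoc s (s ^ d) _ ⟩
      s * (s ^ d * p ^ (2 * suc t))        ≤⟨ walksBack-via-part {f = f} {j = d + 2 * suc t}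
                                                (small (suc (part c)) 2≤next next≤) (cycleAdj-suc m (part c) (s≤s next≤)) refl
                                                (λ x x∈next → climb d t x (trans (cong (_+ d) x∈next) (trans (sym (+-suc (part c) d)) top))
                                                                        (≤-trans 2≤next (≤-reflexive (sym x∈next)))) ⟩
      walksBack G f c (suc d + 2 * suc t)  ∎
      where
      open ≤-Reasoning
      2≤next : 2 ≤ suc (part c)
      2≤next = ≤-trans 2≤c (n≤1+n _)
      next≤ : suc (part c) ≤ suc (suc ℓ')
      next≤ = subst (suc (part c) ≤_) (trans (sym (+-suc (part c) d)) top) (s≤s (m≤m+n (part c) d))

  closedWalks-around-and-bounce : ∀ t → s ^ suc ℓ' * p ^ (2 * suc t) ≤ closedWalks G (suc ℓ' + 2 * suc t)
  closedWalks-around-and-bounce t = begin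
    s ^ suc ℓ' * p ^ (2 * suc t)                        ≡⟨ *-assoc s (s ^ ℓ') _ ⟩
    s * (s ^ ℓ' * p ^ (2 * suc t))                      ≤⟨ *-monoˡ-≤ _ (small 2 ≤-refl (s≤s (s≤s z≤n))) ⟩
    partSize part 2 * (s ^ ℓ' * p ^ (2 * suc t))        ≤⟨ closedWalks-≥ G (λ y → part y ≡ᵇ 2) (ℓ' + 2 * suc t) _
                                                             (λ x e → climb x (≡ᵇ-sound e) ℓ' t x (cong (_+ ℓ') (≡ᵇ-sound e))
                                                                            (≤-reflexive (sym (≡ᵇ-sound e)))) ⟩
    closedWalks G (suc ℓ' + 2 * suc t)                  ∎
    where open ≤-Reasoning

<ᵇ-true : ∀ {i h} → i < h → (i <ᵇ h) ≡ true
<ᵇ-true i<h = Equivalence.to T-≡ (<⇒<ᵇ i<h)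

<ᵇ-false : ∀ {i h} → h ≤ i → (i <ᵇ h) ≡ false
<ᵇ-false {i} {h} h≤i with i <ᵇ h in e
... | false = refl
... | true = ⊥-elim (<⇒≱ (<ᵇ⇒< i h (Equivalence.from T-≡ e)) h≤i)

unbalancedPart : (h r : ℕ) → ℕ
unbalancedPart h r = if r <ᵇ h then 0 else if r <ᵇ h + h then 1 else r ∸ (h + h) + 2

module _ (ℓ h : ℕ) .{{_ : NonZero (h + (h + ℓ))}} where

  private
    M = h + (h + ℓ)

  unbalancedBlowUpPart : Fin n → ℕ
  unbalancedBlowUpPart i = unbalancedPart h (toℕ i % M)

  partSize-unbalanced : ∀ n r c → c ≤ countBelow (λ i → unbalancedPart h i ≡ᵇ r) M →
    (n / M) * c ≤ partSize (unbalancedBlowUpPart {n}) r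
  partSize-unbalanced n r c c≤ = begin
    (n / M) * c                                                 ≤⟨ *-monoʳ-≤ (n / M) c≤ ⟩
    (n / M) * countBelow inPart M                               ≡⟨ sym (countBelow-periodic inPart M (n / M)) ⟩
    countBelow (λ i → inPart (i % M)) (n / M * M)               ≤⟨ countBelow-mono _ (m/n*n≤m n M) ⟩
    countBelow (λ i → inPart (i % M)) n                         ≡⟨ sym (countTrue-allFin n _) ⟩
    partSize (unbalancedBlowUpPart {n}) r                       ∎
    where
    open ≤-Reasoning
    inPart : ℕ → Bool
    inPart i = unbalancedPart h i ≡ᵇ r

  period-part0 : h ≤ countBelow (λ i → unbalancedPart h i ≡ᵇ 0) M
  period-part0 = begin
    h                                                ≡⟨ sym (countBelow-all _ h first-block) ⟩
    countBelow (λ i → unbalancedPart h i ≡ᵇ 0) h     ≤⟨ countBelow-mono _ (m≤m+n h (h + ℓ)) ⟩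
    countBelow (λ i → unbalancedPart h i ≡ᵇ 0) M     ∎
    where
    open ≤-Reasoning
    first-block : ∀ i → i < h → (unbalancedPart h i ≡ᵇ 0) ≡ true
    first-block i i<h rewrite <ᵇ-true i<h = refl

  period-part1 : h ≤ countBelow (λ i → unbalancedPart h i ≡ᵇ 1) M
  period-part1 = begin
    h                                                      ≡⟨ sym (countBelow-all _ h second-block) ⟩
    countBelow (λ i → unbalancedPart h (h + i) ≡ᵇ 1) h     ≤⟨ countBelow-mono _ (m≤m+n h ℓ) ⟩
    countBelow (λ i → unbalancedPart h (h + i) ≡ᵇ 1) (h + ℓ) ≤⟨ m≤n+m _ _ ⟩
    countBelow (λ i → unbalancedPart h i ≡ᵇ 1) h + countBelow (λ i → unbalancedPart h (h + i) ≡ᵇ 1) (h + ℓ)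
                                                           ≡⟨ sym (countBelow-+ _ h (h + ℓ)) ⟩
    countBelow (λ i → unbalancedPart h i ≡ᵇ 1) M           ∎
    where
    open ≤-Reasoning
    second-block : ∀ i → i < h → (unbalancedPart h (h + i) ≡ᵇ 1) ≡ true
    second-block i i<h rewrite <ᵇ-false {h + i} {h} (m≤m+n h i) | <ᵇ-true (+-monoʳ-< h i<h) = refl

  period-small-part : ∀ r → 2 ≤ r → r ≤ suc ℓ → 1 ≤ countBelow (λ i → unbalancedPart h i ≡ᵇ r) M
  period-small-part (suc zero) (s≤s ()) _
  period-small-part (suc (suc j)) _ (s≤s j<ℓ) = countBelow-pos _ M (h + h + j) residue<M hit
    where
    residue<M : h + h + j < M
    residue<M = subst (h + h + j <_) (+-assoc h h ℓ) (+-monoʳ-< (h + h) j<ℓ)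
    hit : (unbalancedPart h (h + h + j) ≡ᵇ suc (suc j)) ≡ true
    hit rewrite <ᵇ-false {h + h + j} {h} (≤-trans (m≤m+n h h) (m≤m+n _ _))
              | <ᵇ-false {h + h + j} {h + h} (m≤m+n _ _)
              | m+n∸m≡n (h + h) j
              | +-comm j 2 = ≡ᵇ-refl (suc (suc j))

  unbalancedBlowUpPart< : (i : Fin n) → unbalancedBlowUpPart i < suc (suc ℓ)
  unbalancedBlowUpPart< i = part< (toℕ i % M) (m%n<n (toℕ i) M)
    where
    part< : ∀ r → r < M → unbalancedPart h r < suc (suc ℓ)
    part< r r<M with r <ᵇ h | r <ᵇ h + h in e
    ... | true | _ = s≤s z≤n
    ... | false | true = s≤s (s≤s z≤n)
    ... | false | false = subst (_< suc (suc ℓ)) (+-comm 2 (r ∸ (h + h))) (s≤s (s≤s offset<ℓ))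
      where
      h+h≤r : h + h ≤ r
      h+h≤r = ≮⇒≥ (λ r<h+h → subst T e (<⇒<ᵇ r<h+h))
      offset<ℓ : r ∸ (h + h) < ℓ
      offset<ℓ = subst (r ∸ (h + h) <_) (trans (cong (_∸ (h + h)) (sym (+-assoc h h ℓ))) (m+n∸m≡n (h + h) ℓ))
                   (∸-monoˡ-< r<M h+h≤r)

-- Arithmetic

^-distribʳ-* : ∀ x y k → (x * y) ^ k ≡ x ^ k * y ^ k
^-distribʳ-* x y zero = refl
^-distribʳ-* x y (suc k) rewrite ^-distribʳ-* x y k = interchange x y (x ^ k) (y ^ k)
  where
  interchange : ∀ x y u v → x * y * (u * v) ≡ x * u * (y * v)
  interchange = solve-∀

bernoulli : ∀ a K → a ^ K * (a + suc K) ≤ suc a ^ suc K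
bernoulli a zero = ≤-reflexive (base a)
  where
  base : ∀ a → 1 * (a + 1) ≡ (1 + a) * 1
  base = solve-∀
bernoulli a (suc K) = begin
  a * a ^ K * (a + suc (suc K))              ≡⟨ expand a (a ^ K) K ⟩
  a * (a ^ K * (a + suc K)) + a * a ^ K      ≤⟨ +-mono-≤ (*-monoʳ-≤ a (bernoulli a K)) (^-monoˡ-≤ (suc K) (n≤1+n a)) ⟩
  a * suc a ^ suc K + suc a ^ suc K          ≡⟨ +-comm (a * suc a ^ suc K) _ ⟩
  suc a * suc a ^ suc K                      ∎
  where
  open ≤-Reasoning
  expand : ∀ a x K → a * x * (a + (2 + K)) ≡ a * (x * (a + (1 + K))) + a * x
  expand = solve-∀

m<[1+m/n]*n : ∀ x c .{{_ : NonZero c}} → x < suc (x / c) * c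
m<[1+m/n]*n x c = begin-strict
  x                      ≡⟨ m≡m%n+[m/n]*n x c ⟩
  x % c + x / c * c      <⟨ +-monoˡ-< _ (m%n<n x c) ⟩
  c + x / c * c          ∎
  where open ≤-Reasoning

-- Rounding both counts down to multiples of c costs less than c·Z on the right.
/-gap : ∀ X Y N Z c .{{_ : NonZero c}} .{{_ : NonZero Z}} →
  X * Z + c * N + c * Z ≤ Y * Z → (X / c) * Z + N ≤ (Y / c) * Z
/-gap X Y N Z c gap = <⇒≤ (*-cancelˡ-< c _ _ (+-cancelʳ-< (c * Z) _ _ (begin-strict
  c * ((X / c) * Z + N) + c * Z    ≡⟨ expand c (X / c) Z N ⟩
  (X / c * c) * Z + c * N + c * Z  ≤⟨ +-monoˡ-≤ _ (+-monoˡ-≤ _ (*-monoˡ-≤ Z (m/n*n≤m X c))) ⟩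
  X * Z + c * N + c * Z            ≤⟨ gap ⟩
  Y * Z                            <⟨ *-monoˡ-< Z (m<[1+m/n]*n Y c) ⟩
  suc (Y / c) * c * Z              ≡⟨ collect c (Y / c) Z ⟩
  c * ((Y / c) * Z) + c * Z        ∎)))
  where
  open ≤-Reasoning
  expand : ∀ c x Z N → c * (x * Z + N) + c * Z ≡ x * c * Z + c * N + c * Z
  expand = solve-∀
  collect : ∀ c y Z → suc y * c * Z ≡ c * (y * Z) + c * Z
  collect = solve-∀

-- In the application X and Y are the labelled k-cycle counts of the balanced and the unbalanced
-- blow-up, V is the lower bound on closed walks of the latter and ND counts non-injective tuples.
module _ (m h A a E K q n X Y V ND Z : ℕ) .{{E≢0 : NonZero E}} .{{m≢0 : NonZero m}}
  (m^K*X≤ : m ^ K * X ≤ A * a ^ K * q ^ suc K)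
  (≤W*V : (h * m) ^ suc K * q ^ suc K ≤ E * m ^ K * V)
  (V≤Y+ND : V ≤ Y + ND)
  (ND≤ : ND ≤ suc K * suc K * n ^ K)
  (n≤A*q : n ≤ A * q) (1≤a : 1 ≤ a) (a<h*m : a < h * m)
  (k-large : E * A + 2 ≤ a + suc K)
  (q-large : E * m ^ K * (2 * suc K + suc K * suc K * A ^ K) ≤ q)
  (Z-large : E * m ^ K * (2 * suc K) * A ^ suc K ≤ Z) where

  private
    k = suc K
    c = 2 * k
    W = E * m ^ K
    qᵏ = q ^ k
    aᴷqᵏ = a ^ K * qᵏ

    instance
      W≢0 : NonZero W
      W≢0 = m*n≢0 E (m ^ K) ⦃ E≢0 ⦄ ⦃ m^n≢0 m K ⦄

    1≤q : 1 ≤ q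
    1≤q = ≤-trans (s≤s z≤n) (≤-trans (m≤m+n c _) (≤-trans (m≤n*m _ W) q-large))

    instance
      q≢0 : NonZero q
      q≢0 = >-nonZero 1≤q

  private
    -- Bernoulli's inequality turns the margin a + k ≥ E·A + 2 into room for 2·aᴷqᵏ.
    W*X+2aᴷqᵏ≤W*V : W * X + 2 * aᴷqᵏ ≤ W * V
    W*X+2aᴷqᵏ≤W*V = begin
      W * X + 2 * aᴷqᵏ                  ≡⟨ cong (_+ 2 * aᴷqᵏ) (*-assoc E (m ^ K) X) ⟩
      E * (m ^ K * X) + 2 * aᴷqᵏ        ≤⟨ +-monoˡ-≤ _ (*-monoʳ-≤ E m^K*X≤) ⟩
      E * (A * a ^ K * qᵏ) + 2 * aᴷqᵏ   ≡⟨ collect E A (a ^ K) qᵏ ⟩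
      a ^ K * (E * A + 2) * qᵏ          ≤⟨ *-monoˡ-≤ qᵏ (*-monoʳ-≤ (a ^ K) k-large) ⟩
      a ^ K * (a + k) * qᵏ              ≤⟨ *-monoˡ-≤ qᵏ (bernoulli a K) ⟩
      suc a ^ k * qᵏ                    ≤⟨ *-monoˡ-≤ qᵏ (^-monoˡ-≤ k a<h*m) ⟩
      (h * m) ^ k * qᵏ                  ≤⟨ ≤W*V ⟩
      W * V                             ∎
      where
      open ≤-Reasoning
      collect : ∀ e x y z → e * (x * y * z) + 2 * (y * z) ≡ y * (e * x + 2) * z
      collect = solve-∀

    W*c*nᵏ≤Z*qᵏ : W * c * n ^ k ≤ Z * qᵏ
    W*c*nᵏ≤Z*qᵏ = begin
      W * c * n ^ k             ≤⟨ *-monoʳ-≤ (W * c) (^-monoˡ-≤ k n≤A*q) ⟩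
      W * c * (A * q) ^ k       ≡⟨ cong (W * c *_) (^-distribʳ-* A q k) ⟩
      W * c * (A ^ k * qᵏ)      ≡⟨ sym (*-assoc (W * c) (A ^ k) qᵏ) ⟩
      W * c * A ^ k * qᵏ        ≤⟨ *-monoˡ-≤ qᵏ Z-large ⟩
      Z * qᵏ                    ∎
      where open ≤-Reasoning

    W*c+W*ND≤qᵏ : W * c + W * ND ≤ qᵏ
    W*c+W*ND≤qᵏ = begin
      W * c + W * ND                                          ≤⟨ +-mono-≤ (*-monoʳ-≤ W c≤c*qᴷ) (*-monoʳ-≤ W (≤-trans ND≤ (*-monoʳ-≤ (k * k) nᴷ≤))) ⟩
      W * (c * q ^ K) + W * (k * k * (A ^ K * q ^ K))         ≡⟨ collect W c (k * k) (A ^ K) (q ^ K) ⟩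
      W * (c + k * k * A ^ K) * q ^ K                         ≤⟨ *-monoˡ-≤ (q ^ K) q-large ⟩
      qᵏ                                                      ∎
      where
      open ≤-Reasoning
      c≤c*qᴷ : c ≤ c * q ^ K
      c≤c*qᴷ = m≤m*n c (q ^ K) ⦃ m^n≢0 q K ⦄
      nᴷ≤ : n ^ K ≤ A ^ K * q ^ K
      nᴷ≤ = ≤-trans (^-monoˡ-≤ K n≤A*q) (≤-reflexive (^-distribʳ-* A q K))
      collect : ∀ w c kk aK qK → w * (c * qK) + w * (kk * (aK * qK)) ≡ w * (c + kk * aK) * qK
      collect = solve-∀

  cycle-count-gap : X * Z + 2 * suc K * n ^ suc K + 2 * suc K * Z ≤ Y * Z
  cycle-count-gap = *-cancelˡ-≤ W (+-cancelʳ-≤ (Z * (W * ND)) _ _ (begin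
    W * (X * Z + c * n ^ k + c * Z) + Z * (W * ND)       ≡⟨ regroup W X Z c (n ^ k) ND ⟩
    Z * (W * X) + W * c * n ^ k + Z * (W * c + W * ND)   ≤⟨ +-mono-≤ (+-monoʳ-≤ _ (≤-trans W*c*nᵏ≤Z*qᵏ (*-monoʳ-≤ Z qᵏ≤aᴷqᵏ)))
                                                                     (*-monoʳ-≤ Z (≤-trans W*c+W*ND≤qᵏ qᵏ≤aᴷqᵏ)) ⟩
    Z * (W * X) + Z * aᴷqᵏ + Z * aᴷqᵏ                    ≡⟨ factor Z (W * X) aᴷqᵏ ⟩
    Z * (W * X + 2 * aᴷqᵏ)                               ≤⟨ *-monoʳ-≤ Z W*X+2aᴷqᵏ≤W*V ⟩
    Z * (W * V)                                          ≤⟨ *-monoʳ-≤ Z (*-monoʳ-≤ W V≤Y+ND) ⟩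
    Z * (W * (Y + ND))                                   ≡⟨ distribute Z W Y ND ⟩
    W * (Y * Z) + Z * (W * ND)                           ∎))
    where
    open ≤-Reasoning
    qᵏ≤aᴷqᵏ : qᵏ ≤ aᴷqᵏ
    qᵏ≤aᴷqᵏ = m≤n*m qᵏ (a ^ K) ⦃ m^n≢0 a K ⦃ >-nonZero 1≤a ⦄ ⦄
    regroup : ∀ w x z c nk d → w * (x * z + c * nk + c * z) + z * (w * d) ≡ z * (w * x) + w * c * nk + z * (w * c + w * d)
    regroup = solve-∀
    factor : ∀ z x y → z * x + z * y + z * y ≡ z * (x + 2 * y)
    factor = solve-∀
    distribute : ∀ z w y d → z * (w * (y + d)) ≡ w * (y * z) + z * (w * d)
    distribute = solve-∀

-- The construction

odd-gap : ∀ {ℓ k} → Odd ℓ → Odd k → ℓ < k → ∃[ t ] k ≡ ℓ + 2 * suc t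
odd-gap {ℓ} {k} (b , refl) (c , refl) ℓ<k = c ∸ suc b , (begin
  suc (2 * c)                        ≡⟨ cong (λ z → suc (2 * z)) (sym (m+[n∸m]≡n b<c)) ⟩
  suc (2 * (suc b + (c ∸ suc b)))    ≡⟨ expand b (c ∸ suc b) ⟩
  suc (2 * b) + 2 * suc (c ∸ suc b)  ∎)
  where
  open ≡-Reasoning
  b<c : b < c
  b<c = *-cancelˡ-< 2 b c (s≤s⁻¹ ℓ<k)
  expand : ∀ b t → suc (2 * (suc b + t)) ≡ suc (2 * b) + 2 * suc t
  expand = solve-∀

HasMoreCycles : ℕ → (G H : (n : ℕ) → Graph n) → Set
HasMoreCycles k G H = ∃[ d ] ∃[ N ] ∀ n → N ≤ n → copiesC k (H n) * suc d + n ^ k ≤ copiesC k (G n) * suc d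

module Construction (x : ℕ) where

  ℓ m h M M⁺ a E : ℕ
  ℓ = 3 + x
  m = 2 + ℓ
  h = 2 * m
  M = h + (h + ℓ)
  M⁺ = suc M
  a = 2 * M⁺
  E = m * h ^ ℓ

  instance
    E≢0 : NonZero E
    E≢0 = m*n≢0 m (h ^ ℓ) ⦃ _ ⦄ ⦃ m^n≢0 h ℓ ⦄

  part : Fin n → ℕ
  part = unbalancedBlowUpPart ℓ h

  G : ∀ n → Graph n
  G n = cycleBlowUp m (part {n})

  G-simple : ∀ n → IsSimpleGraph (G n)
  G-simple n = cycleBlowUp-simple m (part {n}) (s≤s (s≤s z≤n)) (unbalancedBlowUpPart< ℓ h)

  G-CycleFree : Odd ℓ → ∀ n → CycleFree ℓ (G n)
  G-CycleFree odd n = cycleBlowUp-CycleFree m (part {n}) ℓ odd (≤-trans (n<1+n ℓ) (n≤1+n (suc ℓ)))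

  a<h*m : a < h * m
  a<h*m = subst (suc a ≤_) (sym (expand x)) (m≤m+n (suc a) _)
    where
    expand : ∀ x → 2 * (5 + x) * (5 + x) ≡ suc (2 * suc (2 * (5 + x) + (2 * (5 + x) + (3 + x)))) + (1 + 10 * x + 2 * x * x)
    expand = solve-∀

  module _ (t : ℕ) (k-large : E * M⁺ + 2 ≤ a + (ℓ + 2 * suc t)) where

    j K k W Q d N₀ : ℕ
    j = 2 * suc t
    K = suc (suc x) + j
    k = suc K
    W = E * m ^ K
    Q = suc (M + m + W * (2 * k + k * k * M⁺ ^ K))
    d = W * (2 * k) * M⁺ ^ k
    N₀ = Q * M

    module _ (n : ℕ) (N₀≤n : N₀ ≤ n) where

      q X Y V ND : ℕ
      q = n / M
      X = labelledCycles k (balancedBlowUp m n)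
      Y = labelledCycles k (G n)
      V = q ^ ℓ * (q * h) ^ j
      ND = nonInjective n k

      instance
        n≢0 : NonZero n
        n≢0 = >-nonZero (≤-trans (s≤s z≤n) N₀≤n)

      Q≤q : Q ≤ q
      Q≤q = subst (_≤ q) (m*n/n≡m Q M) (/-monoˡ-≤ M N₀≤n)

      m+n≤M⁺*q : m + n ≤ M⁺ * q
      m+n≤M⁺*q = begin
        m + n                ≤⟨ +-monoʳ-≤ m (<⇒≤ (m<[1+m/n]*n n M)) ⟩
        m + suc q * M        ≡⟨ regroup m M q ⟩
        (M + m) + M * q      ≤⟨ +-monoˡ-≤ (M * q) (≤-trans (≤-trans (m≤m+n (M + m) _) (n≤1+n _)) Q≤q) ⟩
        q + M * q            ∎
        where
        open ≤-Reasoning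
        regroup : ∀ m M q → m + (1 + q) * M ≡ (M + m) + M * q
        regroup = solve-∀

      n≤M⁺*q : n ≤ M⁺ * q
      n≤M⁺*q = ≤-trans (m≤n+m n m) m+n≤M⁺*q

      D : ℕ
      D = suc (n / m) * 2

      m*D≤a*q : m * D ≤ a * q
      m*D≤a*q = begin
        m * D                    ≡⟨ regroup m (n / m) ⟩
        2 * (m + n / m * m)      ≤⟨ *-monoʳ-≤ 2 (+-monoʳ-≤ m (m/n*n≤m n m)) ⟩
        2 * (m + n)              ≤⟨ *-monoʳ-≤ 2 m+n≤M⁺*q ⟩
        2 * (M⁺ * q)             ≡⟨ sym (*-assoc 2 M⁺ q) ⟩
        a * q                    ∎
        where
        open ≤-Reasoning
        regroup : ∀ m y → m * ((1 + y) * 2) ≡ 2 * (m + y * m)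
        regroup = solve-∀

      m^K*X≤ : m ^ K * X ≤ M⁺ * a ^ K * q ^ k
      m^K*X≤ = begin
        m ^ K * X                  ≤⟨ *-monoʳ-≤ (m ^ K) (≤-trans (labelledCycles-≤ (balancedBlowUp m n) k)
                                        (closedWalks-≤ (balancedBlowUp m n) D (balancedBlowUp-degree (suc ℓ) n) K)) ⟩
        m ^ K * (n * D ^ K)        ≡⟨ x*[y*z]≡y*[x*z] (m ^ K) n (D ^ K) ⟩
        n * (m ^ K * D ^ K)        ≡⟨ cong (n *_) (sym (^-distribʳ-* m D K)) ⟩
        n * (m * D) ^ K            ≤⟨ *-mono-≤ n≤M⁺*q (^-monoˡ-≤ K m*D≤a*q) ⟩
        M⁺ * q * (a * q) ^ K       ≡⟨ cong (M⁺ * q *_) (^-distribʳ-* a q K) ⟩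
        M⁺ * q * (a ^ K * q ^ K)   ≡⟨ regroup M⁺ q (a ^ K) (q ^ K) ⟩
        M⁺ * a ^ K * q ^ k         ∎
        where
        open ≤-Reasoning
        x*[y*z]≡y*[x*z] : ∀ x y z → x * (y * z) ≡ y * (x * z)
        x*[y*z]≡y*[x*z] = solve-∀
        regroup : ∀ A q aK qK → A * q * (aK * qK) ≡ A * aK * (q * qK)
        regroup = solve-∀

      W*V≡ : W * V ≡ (h * m) ^ k * q ^ k
      W*V≡ = begin
        W * V                                          ≡⟨ cong (λ z → W * (q ^ ℓ * z)) (^-distribʳ-* q h j) ⟩
        m * h ^ ℓ * m ^ K * (q ^ ℓ * (q ^ j * h ^ j))  ≡⟨ shuffle m (h ^ ℓ) (m ^ K) (q ^ ℓ) (q ^ j) (h ^ j) ⟩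
        h ^ ℓ * h ^ j * (m * m ^ K) * (q ^ ℓ * q ^ j)  ≡⟨ sym (cong₂ (λ u v → u * (m * m ^ K) * v) (^-distribˡ-+-* h ℓ j) (^-distribˡ-+-* q ℓ j)) ⟩
        h ^ k * m ^ k * q ^ k                          ≡⟨ cong (_* q ^ k) (sym (^-distribʳ-* h m k)) ⟩
        (h * m) ^ k * q ^ k                            ∎
        where
        open ≡-Reasoning
        shuffle : ∀ m hℓ mK qℓ qj hj → m * hℓ * mK * (qℓ * (qj * hj)) ≡ hℓ * hj * (m * mK) * (qℓ * qj)
        shuffle = solve-∀

      V≤Y+ND : V ≤ Y + ND
      V≤Y+ND = ≤-trans
        (closedWalks-around-and-bounce (suc (suc x)) (part {n}) (q * h) q
          (partSize-unbalanced ℓ h n 0 h (period-part0 ℓ h))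
          (partSize-unbalanced ℓ h n 1 h (period-part1 ℓ h))
          (λ r 2≤r r≤ → subst (_≤ partSize (part {n}) r) (*-identityʳ q) (partSize-unbalanced ℓ h n r 1 (period-small-part ℓ h r 2≤r r≤)))
          t)
        (closedWalks-≤-labelledCycles+nonInjective (G n) k)

      q-large : W * (2 * k + k * k * M⁺ ^ K) ≤ q
      q-large = ≤-trans (≤-trans (m≤n+m _ (M + m)) (n≤1+n _)) Q≤q

      beats-balanced : copiesC k (balancedBlowUp m n) * suc d + n ^ k ≤ copiesC k (G n) * suc d
      beats-balanced = /-gap X Y (n ^ k) (suc d) (2 * k)
        (cycle-count-gap m h M⁺ a E K q n X Y V ND (suc d) m^K*X≤ (≤-reflexive (sym W*V≡)) V≤Y+ND
          (nonInjective-≤ n K) n≤M⁺*q (s≤s z≤n) a<h*m k-large q-large (n≤1+n d))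

    more-cycles : HasMoreCycles k G (balancedBlowUp m)
    more-cycles = d , N₀ , beats-balanced

  more-cycles-for-odd : Odd ℓ → ∀ k → E * M⁺ + m ≤ k → Odd k → HasMoreCycles k G (balancedBlowUp m)
  more-cycles-for-odd oddℓ k k₀≤k oddk = from-gap (odd-gap oddℓ oddk ℓ<k)
    where
    ℓ<k : ℓ < k
    ℓ<k = ≤-trans (n≤1+n (suc ℓ)) (≤-trans (m≤n+m m (E * M⁺)) k₀≤k)
    from-gap : ∃[ t ] k ≡ ℓ + 2 * suc t → HasMoreCycles k G (balancedBlowUp m)
    from-gap (t , k≡) = subst (λ k → HasMoreCycles k G (balancedBlowUp m)) (sym k≡) (more-cycles t k-large)
      where
      k-large : E * M⁺ + 2 ≤ a + (ℓ + 2 * suc t)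
      k-large = ≤-trans (+-monoʳ-≤ (E * M⁺) (s≤s (s≤s z≤n))) (≤-trans k₀≤k (≤-trans (≤-reflexive k≡) (m≤n+m _ a)))

theorem1p2 : ∀ (ℓ : ℕ) → Odd ℓ → 3 ≤ ℓ →
    ∃[ k₀ ] ∀ (k : ℕ) → k₀ ≤ k → Odd k →
    Σ[ G ∈ ((n : ℕ) → Graph n) ] ((∀ (n : ℕ) → IsSimpleGraph (G n))
    × (∀ (n : ℕ) → CycleFree ℓ (G n))
    × ∃[ d ] ∃[ N ] ∀ (n : ℕ) → N ≤ n →
    copiesC k (balancedBlowUp (2 + ℓ) n) * suc d + n ^ k
    ≤ copiesC k (G n) * suc d)
theorem1p2 _ oddℓ (s≤s (s≤s (s≤s {n = x} z≤n))) = E * M⁺ + m , λ k k₀≤k oddk →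
  G , G-simple , G-CycleFree oddℓ , more-cycles-for-odd oddℓ k k₀≤k oddk
  where open Construction x
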